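{- Let $n\ge 0$ and $M,N\in\mathcal{M}(n)$ be two matchings such that the multisets $ca(\mathcal{T}(M,l))$ and $ca(\mathcal{T}(N,l))$ are equal for $l=0,1$. Then $ca(\mathcal{T}(M,l))=ca(\mathcal{T}(N,l))$ for all $l\ge 0$.
   Context: A matching on $[2n]$ is a partition of $[2n]$ into $n$ two-element blocks (edges); $\mathcal{M}(n)$ is the set of such matchings, $\mathcal{M}(0)=\{\emptyset\}$. Two distinct edges $A,B$ form a camel if $\max A<\min B$ or $\max B<\min A$; $ca(M)$ is the number of camels (unordered pairs of edges forming a camel) in $M$. For $M\in\mathcal{M}(m)$, its children are the matchings obtained by choosing $x\in\{2,\dots,2m+2\}$, relabeling the vertices of $M$ order-preservingly by $\{2,\dots,2m+2\}\setminus\{x\}$ and adding the edge $\{1,x\}$; $\mathcal{T}(M,0)=\{M\}$ and $\mathcal{T}(M,l+1)$ is the set of children of members of $\mathcal{T}(M,l)$. $ca(Z)$ is the multiset of values $ca(P)$, $P\in Z$, with multiplicities. -}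

module Defs where

open import Data.Nat using (ℕ; zero; suc; _+_; _*_; _<_; _<ᵇ_; _⊔_; _⊓_)
open import Data.Bool using (Bool; true; false; if_then_else_; _∨_)
open import Data.Product using (_×_; _,_; proj₁; proj₂)
open import Data.List using (List; []; _∷_; map; concatMap; length; filter)
open import Data.List.Relation.Binary.Permutation.Propositional using (_↭_)
open import Relation.Binary.PropositionalEquality using (_≡_)

-- An edge is an (unordered) two-element block, stored as a pair of labels.
Edge : Set
Edge = ℕ × ℕ

range : ℕ → ℕ → List ℕ
range a zero    = []
range a (suc k) = a ∷ range (suc a) k

vertices : List Edge → List ℕ
vertices = concatMap (λ e → proj₁ e ∷ proj₂ e ∷ [])

-- A list of edges is a matching on [2n] = {1,…,2n}: each vertex of [2n]
-- occurs in exactly one edge, exactly once (so every edge has two distinct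
-- endpoints and edges are pairwise disjoint, and there are exactly n edges).
IsMatching : ℕ → List Edge → Set
IsMatching n es = vertices es ↭ range 1 (2 * n)

emax emin : Edge → ℕ
emax (a , b) = a ⊔ b
emin (a , b) = a ⊓ b

camel : Edge → Edge → Bool
camel A B = (emax A <ᵇ emin B) ∨ (emax B <ᵇ emin A)

countB : List Bool → ℕ
countB []          = 0
countB (true ∷ bs) = suc (countB bs)
countB (false ∷ bs) = countB bs

ca : List Edge → ℕ
ca []       = 0
ca (e ∷ es) = countB (map (camel e) es) + ca es

-- order-preserving relabelling of [2m] onto {2,…,2m+2} \ {x}
relabel : ℕ → ℕ → ℕ
relabel x v = if suc v <ᵇ x then suc v else suc (suc v)

relabelEdge : ℕ → Edge → Edge
relabelEdge x (a , b) = relabel x a , relabel x b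

children : ℕ → List Edge → List (List Edge)
children m es = map (λ x → (1 , x) ∷ map (relabelEdge x) es) (range 2 (suc (2 * m)))

-- T(M,l) for M ∈ 𝓜(m), as a list (its members lie in 𝓜(m+l))
T : ℕ → List Edge → ℕ → List (List Edge)
T m es zero    = es ∷ []
T m es (suc l) = concatMap (children (m + l)) (T m es l)

-- the multiset ca(T(M,l)), as a list (multiset equality = permutation _↭_)
caT : ℕ → List Edge → ℕ → List ℕ
caT m es l = map ca (T m es l)

module Submission where

-- Let e_j(M) be the number of edges of M with both ends greater than j, and call the
-- multiset {e_0(M), …, e_2m(M)} the profile of M ∈ 𝓜(m).  In the child of M whose new
-- edge is {1, i+2}, that edge forms a camel exactly with the old edges beyond i, so the
-- child has ca(M) + e_i(M) camels; its profile is that of M together with e_i(M) and |M|+1,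
-- since the cut after j moves to j+1 for j ≤ i and to j+2 for j ≥ i, and the cut after 0
-- sees every edge.  Hence ca(T(M,l)) depends only on ca(M), |M| and the profile of M.
-- Level 0 gives ca(M) = ca(N), and level 1 is the multiset {ca(M) + e_j(M)}, which then
-- determines the profile.

open import Defs
open import Data.Nat using (ℕ; zero; suc; _+_; _*_; _∸_; _≤_; _<_; _<ᵇ_; z≤n; s≤s; s≤s⁻¹; _≤?_; _<?_)
open import Data.Nat.Properties
  using (+-suc; +-identityʳ; *-suc; *-cancelˡ-≡; m+n∸n≡m; ≤-refl; ≤-trans; <-trans; ≤-<-trans; <-irrefl; <⇒≤; ≰⇒>; ≮⇒≥; m≤m+n; m≤n⇒m≤1+n; m≤n⇒m<n∨m≡n; m≤n⇒∃[o]m+o≡n; mono-≤-distrib-⊔; mono-≤-distrib-⊓)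
open import Data.Bool using (Bool; true; false)
open import Data.Bool.Properties using (∨-identityʳ)
open import Data.Product using (_,_)
open import Data.Sum using (inj₁; inj₂)
open import Data.List using (List; []; _∷_; [_]; map; concatMap; length; _++_)
open import Data.List.Properties using (∷-injectiveˡ; map-∘; map-cong; map-id; map-++; map-cong-local; length-map; ++-identityʳ; concatMap-pure; concatMap-map; map-concatMap)
open import Data.List.Effectful using (module MonadProperties)
open import Data.List.Relation.Unary.All using (All; []; _∷_; universal)
open import Data.List.Relation.Binary.Permutation.Propositional using (_↭_; refl; prep; swap; trans; module PermutationReasoning)
open import Data.List.Relation.Binary.Permutation.Propositional.Properties using (↭-singleton-inv; ↭-length; ++⁺; ++⁺ˡ; shift; shifts; map⁺)
open import Relation.Binary.Core using (_Preserves_⟶_)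
open import Relation.Nullary using (yes; no)
open import Relation.Binary.PropositionalEquality using (_≡_; refl; sym; cong; cong₂; subst; module ≡-Reasoning)
  renaming (trans to ≡-trans)
open import Data.Empty using (⊥-elim)

<ᵇ-true : ∀ {m n} → m < n → (m <ᵇ n) ≡ true
<ᵇ-true {zero}  {suc n} _       = refl
<ᵇ-true {suc m} {suc n} (s≤s p) = <ᵇ-true p

<ᵇ-false : ∀ {m n} → n ≤ m → (m <ᵇ n) ≡ false
<ᵇ-false {m}     {zero}  _       = refl
<ᵇ-false {suc m} {suc n} (s≤s p) = <ᵇ-false p

strictMono⇒mono : ∀ {f : ℕ → ℕ} → f Preserves _<_ ⟶ _<_ → f Preserves _≤_ ⟶ _≤_
strictMono⇒mono mono a≤c with m≤n⇒m<n∨m≡n a≤c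
... | inj₁ a<c  = <⇒≤ (mono a<c)
... | inj₂ refl = ≤-refl

<ᵇ-strictMono : ∀ {f : ℕ → ℕ} → f Preserves _<_ ⟶ _<_ → ∀ a c → (f a <ᵇ f c) ≡ (a <ᵇ c)
<ᵇ-strictMono mono a c with a <? c
... | yes a<c = ≡-trans (<ᵇ-true (mono a<c)) (sym (<ᵇ-true a<c))
... | no  a≮c = ≡-trans (<ᵇ-false (strictMono⇒mono mono (≮⇒≥ a≮c))) (sym (<ᵇ-false (≮⇒≥ a≮c)))

relabel-below : ∀ {x v} → suc v < x → relabel x v ≡ suc v
relabel-below {x} {v} p rewrite <ᵇ-true p = refl

relabel-above : ∀ {x v} → x ≤ suc v → relabel x v ≡ suc (suc v)
relabel-above {x} {v} p rewrite <ᵇ-false {suc v} {x} p = refl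

relabel-positive : ∀ x v → 0 < relabel x v
relabel-positive x v with suc v <? x
... | yes p rewrite relabel-below p = s≤s z≤n
... | no  p rewrite relabel-above (≮⇒≥ p) = s≤s z≤n

relabel-strictMono : ∀ x → relabel x Preserves _<_ ⟶ _<_
relabel-strictMono x {a} {c} a<c with suc a <? x | suc c <? x
... | yes p | yes q rewrite relabel-below p | relabel-below q = s≤s a<c
... | yes p | no  q rewrite relabel-below p | relabel-above (≮⇒≥ q) = s≤s (m≤n⇒m≤1+n a<c)
... | no  p | yes q = ⊥-elim (<-irrefl refl (<-trans q (≤-<-trans (≮⇒≥ p) (s≤s a<c))))
... | no  p | no  q rewrite relabel-above (≮⇒≥ p) | relabel-above (≮⇒≥ q) = s≤s (s≤s a<c)

emax-relabelEdge : ∀ x e → emax (relabelEdge x e) ≡ relabel x (emax e)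
emax-relabelEdge x (a , b) = sym (mono-≤-distrib-⊔ (strictMono⇒mono (relabel-strictMono x)) a b)

emin-relabelEdge : ∀ x e → emin (relabelEdge x e) ≡ relabel x (emin e)
emin-relabelEdge x (a , b) = sym (mono-≤-distrib-⊓ (strictMono⇒mono (relabel-strictMono x)) a b)

camel-relabelEdge : ∀ x A B → camel (relabelEdge x A) (relabelEdge x B) ≡ camel A B
camel-relabelEdge x A B
  rewrite emax-relabelEdge x A | emin-relabelEdge x A | emax-relabelEdge x B | emin-relabelEdge x B
        | <ᵇ-strictMono (relabel-strictMono x) (emax A) (emin B)
        | <ᵇ-strictMono (relabel-strictMono x) (emax B) (emin A) = refl

<ᵇ-relabel-left : ∀ {i j} v → j ≤ i → (suc j <ᵇ relabel (2 + i) v) ≡ (j <ᵇ v)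
<ᵇ-relabel-left {i} {j} v j≤i =
  ≡-trans (cong (_<ᵇ relabel (2 + i) v) (sym (relabel-below (s≤s (s≤s j≤i)))))
          (<ᵇ-strictMono (relabel-strictMono (2 + i)) j v)

<ᵇ-relabel-right : ∀ {i j} v → i ≤ j → (2 + j <ᵇ relabel (2 + i) v) ≡ (j <ᵇ v)
<ᵇ-relabel-right {i} {j} v i≤j with v ≤? i
... | yes v≤i rewrite relabel-below {2 + i} (s≤s (s≤s v≤i)) =
  ≡-trans (<ᵇ-false (m≤n⇒m≤1+n (≤-trans v≤i i≤j))) (sym (<ᵇ-false (≤-trans v≤i i≤j)))
... | no  v≰i rewrite relabel-above {2 + i} (s≤s (≰⇒> v≰i)) = refl

countB-map-∘ : ∀ {A B : Set} {f : B → Bool} {h : A → B} {g : A → Bool} →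
  (∀ x → f (h x) ≡ g x) → ∀ xs → countB (map f (map h xs)) ≡ countB (map g xs)
countB-map-∘ f∘h≗g xs = cong countB (≡-trans (sym (map-∘ xs)) (map-cong f∘h≗g xs))

countB-all-true : ∀ {A : Set} {f : A → Bool} → (∀ x → f x ≡ true) → ∀ xs → countB (map f xs) ≡ length xs
countB-all-true f≗true []       = refl
countB-all-true f≗true (x ∷ xs) rewrite f≗true x = cong suc (countB-all-true f≗true xs)

ca-relabel : ∀ x es → ca (map (relabelEdge x) es) ≡ ca es
ca-relabel x []       = refl
ca-relabel x (e ∷ es) = cong₂ _+_ (countB-map-∘ (camel-relabelEdge x e) es) (ca-relabel x es)

edgesAbove : ℕ → List Edge → ℕ
edgesAbove j es = countB (map (λ B → j <ᵇ emin B) es)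

profile : ℕ → List Edge → List ℕ
profile m es = map (λ j → edgesAbove j es) (range 0 (suc (2 * m)))

child : ℕ → List Edge → List Edge
child i es = (1 , 2 + i) ∷ map (relabelEdge (2 + i)) es

ca-child : ∀ i es → ca (child i es) ≡ edgesAbove i es + ca es
ca-child i es = cong₂ _+_ (countB-map-∘ new-camel es) (ca-relabel (2 + i) es)
  where
  new-camel : ∀ B → camel (1 , 2 + i) (relabelEdge (2 + i) B) ≡ (i <ᵇ emin B)
  new-camel B rewrite emin-relabelEdge (2 + i) B | emax-relabelEdge (2 + i) B
                    | <ᵇ-relabel-right (emin B) (≤-refl {i})
                    | <ᵇ-false {relabel (2 + i) (emax B)} {1} (relabel-positive (2 + i) (emax B)) = ∨-identityʳ _

edgesAbove-zero-child : ∀ i es → edgesAbove 0 (child i es) ≡ suc (length es)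
edgesAbove-zero-child i es =
  cong suc (≡-trans (countB-map-∘ positive es) (countB-all-true (λ _ → refl) es))
  where
  positive : ∀ B → (0 <ᵇ emin (relabelEdge (2 + i) B)) ≡ true
  positive B rewrite emin-relabelEdge (2 + i) B = <ᵇ-true (relabel-positive (2 + i) (emin B))

edgesAbove-child-left : ∀ {i j} es → j ≤ i → edgesAbove (suc j) (child i es) ≡ edgesAbove j es
edgesAbove-child-left {i} {j} es j≤i = countB-map-∘ cut es
  where
  cut : ∀ B → (suc j <ᵇ emin (relabelEdge (2 + i) B)) ≡ (j <ᵇ emin B)
  cut B rewrite emin-relabelEdge (2 + i) B = <ᵇ-relabel-left (emin B) j≤i

edgesAbove-child-right : ∀ {i j} es → i ≤ j → edgesAbove (2 + j) (child i es) ≡ edgesAbove j es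
edgesAbove-child-right {i} {j} es i≤j = countB-map-∘ cut es
  where
  cut : ∀ B → (2 + j <ᵇ emin (relabelEdge (2 + i) B)) ≡ (j <ᵇ emin B)
  cut B rewrite emin-relabelEdge (2 + i) B = <ᵇ-relabel-right (emin B) i≤j

range-+ : ∀ s a k → range (s + a) k ≡ map (s +_) (range a k)
range-+ s a zero    = refl
range-+ s a (suc k) = cong (s + a ∷_) (≡-trans (cong (λ b → range b k) (sym (+-suc s a))) (range-+ s (suc a) k))

range-++ : ∀ a p q → range a (p + q) ≡ range a p ++ range (a + p) q
range-++ a zero    q rewrite +-identityʳ a = refl
range-++ a (suc p) q rewrite +-suc a p = cong (a ∷_) (range-++ (suc a) p q)

length-range : ∀ a k → length (range a k) ≡ k
length-range a zero    = refl
length-range a (suc k) = cong suc (length-range (suc a) k)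

range-bounded : ∀ {P : ℕ → Set} a k → (∀ j → a ≤ j → j < a + k → P j) → All P (range a k)
range-bounded a zero    _ = []
range-bounded a (suc k) p =
  p a ≤-refl (subst (a <_) (sym (+-suc a k)) (s≤s (m≤m+n a k)))
  ∷ range-bounded (suc a) k (λ j a<j j<1+a+k → p j (<⇒≤ a<j) (subst (j <_) (sym (+-suc a k)) j<1+a+k))

map-range-shift : ∀ {A : Set} {f g : ℕ → A} s a k → (∀ j → a ≤ j → j < a + k → g (s + j) ≡ f j) →
  map g (range (s + a) k) ≡ map f (range a k)
map-range-shift {g = g} s a k g∘s+≗f =
  ≡-trans (cong (map g) (range-+ s a k)) (≡-trans (sym (map-∘ _)) (map-cong-local (range-bounded a k g∘s+≗f)))

map-range-duplicate : ∀ {A : Set} (f g : ℕ → A) i t →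
  (∀ j → j ≤ i → g (suc j) ≡ f j) → (∀ j → i ≤ j → g (2 + j) ≡ f j) →
  map g (range 1 (2 + (i + t))) ↭ f i ∷ map f (range 0 (suc (i + t)))
map-range-duplicate f g i t left right = begin
  map g (range 1 (2 + (i + t)))
    ≡⟨ cong (λ k → map g (range 1 k)) (sym (+-suc (suc i) t)) ⟩
  map g (range 1 (suc i + suc t))
    ≡⟨ ≡-trans (cong (map g) (range-++ 1 (suc i) (suc t))) (map-++ g (range 1 (suc i)) (range (2 + i) (suc t))) ⟩
  map g (range 1 (suc i)) ++ map g (range (2 + i) (suc t))
    ≡⟨ cong₂ _++_ (map-range-shift 1 0 (suc i) (λ j _ j<1+i → left j (s≤s⁻¹ j<1+i)))
                  (map-range-shift 2 i (suc t) (λ j i≤j _ → right j i≤j)) ⟩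
  map f (range 0 (suc i)) ++ f i ∷ map f (range (suc i) t)
    ↭⟨ shift (f i) (map f (range 0 (suc i))) _ ⟩
  f i ∷ map f (range 0 (suc i)) ++ map f (range (suc i) t)
    ≡⟨ cong (f i ∷_) (≡-trans (sym (map-++ f (range 0 (suc i)) (range (suc i) t))) (cong (map f) (sym (range-++ 0 (suc i) t)))) ⟩
  f i ∷ map f (range 0 (suc (i + t))) ∎
  where open PermutationReasoning

profile-child : ∀ {m i} es → i ≤ 2 * m →
  profile (suc m) (child i es) ↭ suc (length es) ∷ edgesAbove i es ∷ profile m es
profile-child {m} {i} es i≤2m with m≤n⇒∃[o]m+o≡n i≤2m
... | t , i+t≡2m = begin
  map g (range 0 (suc (2 * suc m)))
    ≡⟨ cong (λ k → map g (range 0 (suc k))) (*-suc 2 m) ⟩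
  g 0 ∷ map g (range 1 (2 + 2 * m))
    ≡⟨ cong₂ _∷_ (edgesAbove-zero-child i es) (cong (λ k → map g (range 1 (2 + k))) (sym i+t≡2m)) ⟩
  suc (length es) ∷ map g (range 1 (2 + (i + t)))
    ↭⟨ prep _ (map-range-duplicate f g i t (λ _ → edgesAbove-child-left es) (λ _ → edgesAbove-child-right es)) ⟩
  suc (length es) ∷ f i ∷ map f (range 0 (suc (i + t)))
    ≡⟨ cong (λ k → suc (length es) ∷ f i ∷ map f (range 0 (suc k))) i+t≡2m ⟩
  suc (length es) ∷ f i ∷ profile m es ∎
  where
  open PermutationReasoning
  f g : ℕ → ℕ
  f j = edgesAbove j es
  g j = edgesAbove j (child i es)

module _ {A B : Set} where

  concatMap-cong-↭ : ∀ {f g : A → List B} {xs} → All (λ x → f x ↭ g x) xs → concatMap f xs ↭ concatMap g xs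
  concatMap-cong-↭ []           = refl
  concatMap-cong-↭ (fx↭gx ∷ ps) = ++⁺ fx↭gx (concatMap-cong-↭ ps)

  concatMap⁺ : (f : A → List B) → ∀ {xs ys} → xs ↭ ys → concatMap f xs ↭ concatMap f ys
  concatMap⁺ f refl         = refl
  concatMap⁺ f (prep x p)   = ++⁺ˡ (f x) (concatMap⁺ f p)
  concatMap⁺ f (swap x y p) = trans (shifts (f x) (f y)) (++⁺ˡ (f y) (++⁺ˡ (f x) (concatMap⁺ f p)))
  concatMap⁺ f (trans p q)  = trans (concatMap⁺ f p) (concatMap⁺ f q)

  map⁺-cancel : ∀ {f : A → B} (g : B → A) → (∀ x → g (f x) ≡ x) → ∀ {xs ys} → map f xs ↭ map f ys → xs ↭ ys
  map⁺-cancel {f} g g∘f≗id {xs} {ys} fxs↭fys = begin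
    xs               ≡⟨ unmap xs ⟨
    map g (map f xs) ↭⟨ map⁺ g fxs↭fys ⟩
    map g (map f ys) ≡⟨ unmap ys ⟩
    ys ∎
    where
    open PermutationReasoning
    unmap : ∀ zs → map g (map f zs) ≡ zs
    unmap zs = ≡-trans (sym (map-∘ zs)) (≡-trans (map-cong g∘f≗id zs) (map-id zs))

-- ca(T(M,l)) computed from a = ca(M), k = |M| and the profile L of M alone.
spectrum : ℕ → ℕ → List ℕ → ℕ → List ℕ
spectrum a k L zero    = [ a ]
spectrum a k L (suc l) = concatMap (λ c → spectrum (c + a) (suc k) (suc k ∷ c ∷ L) l) L

spectrum-↭ : ∀ l a k {L L′} → L ↭ L′ → spectrum a k L l ↭ spectrum a k L′ l
spectrum-↭ zero    a k L↭L′ = refl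
spectrum-↭ (suc l) a k {L} L↭L′ =
  trans (concatMap-cong-↭ (universal (λ c → spectrum-↭ l (c + a) (suc k) (prep (suc k) (prep c L↭L′))) L))
        (concatMap⁺ _ L↭L′)

spectrum-one : ∀ a k L → spectrum a k L 1 ≡ map (_+ a) L
spectrum-one a k L = ≡-trans (sym (concatMap-map [_] (_+ a) L)) (concatMap-pure (map (_+ a) L))

children-child : ∀ m es → children m es ≡ map (λ i → child i es) (range 0 (suc (2 * m)))
children-child m es =
  ≡-trans (cong (map (λ x → (1 , x) ∷ map (relabelEdge x) es)) (range-+ 2 0 (suc (2 * m))))
          (sym (map-∘ (range 0 (suc (2 * m)))))

T-suc : ∀ l m es → T m es (suc l) ≡ concatMap (λ Q → T (suc m) Q l) (children m es)
T-suc zero    m es =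
  ≡-trans (++-identityʳ _) (≡-trans (cong (λ k → children k es) (+-identityʳ m)) (sym (concatMap-pure (children m es))))
T-suc (suc l) m es = begin
  concatMap (children (m + suc l)) (T m es (suc l))
    ≡⟨ cong (concatMap (children (m + suc l))) (T-suc l m es) ⟩
  concatMap (children (m + suc l)) (concatMap (λ Q → T (suc m) Q l) (children m es))
    ≡⟨ MonadProperties.associative (children m es) (λ Q → T (suc m) Q l) (children (m + suc l)) ⟨
  concatMap (λ Q → concatMap (children (m + suc l)) (T (suc m) Q l)) (children m es)
    ≡⟨ cong (λ k → concatMap (λ Q → concatMap (children k) (T (suc m) Q l)) (children m es)) (+-suc m l) ⟩
  concatMap (λ Q → T (suc m) Q (suc l)) (children m es) ∎
  where open ≡-Reasoning

caT-spectrum : ∀ l m es → caT m es l ↭ spectrum (ca es) (length es) (profile m es) l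
caT-spectrum zero    m es = refl
caT-spectrum (suc l) m es = begin
  map ca (T m es (suc l))
    ≡⟨ cong (map ca) (≡-trans (T-suc l m es) (cong (concatMap _) (children-child m es))) ⟩
  map ca (concatMap (λ Q → T (suc m) Q l) (map (λ i → child i es) R))
    ≡⟨ ≡-trans (map-concatMap ca (λ Q → T (suc m) Q l) (map (λ i → child i es) R)) (concatMap-map (λ Q → caT (suc m) Q l) (λ i → child i es) R) ⟩
  concatMap (λ i → caT (suc m) (child i es) l) R
    ↭⟨ concatMap-cong-↭ (range-bounded 0 (suc (2 * m)) (λ i _ i<1+2m → grow i (s≤s⁻¹ i<1+2m))) ⟩
  concatMap (λ i → spectrum (edgesAbove i es + ca es) (suc n) (suc n ∷ edgesAbove i es ∷ profile m es) l) R
    ≡⟨ concatMap-map _ (λ j → edgesAbove j es) R ⟨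
  spectrum (ca es) n (profile m es) (suc l) ∎
  where
  open PermutationReasoning
  n = length es
  R = range 0 (suc (2 * m))
  grow : ∀ i → i ≤ 2 * m →
    caT (suc m) (child i es) l ↭ spectrum (edgesAbove i es + ca es) (suc n) (suc n ∷ edgesAbove i es ∷ profile m es) l
  grow i i≤2m = begin
    caT (suc m) (child i es) l
      ↭⟨ caT-spectrum l (suc m) (child i es) ⟩
    spectrum (ca (child i es)) (length (child i es)) (profile (suc m) (child i es)) l
      ≡⟨ cong₂ (λ a k → spectrum a k (profile (suc m) (child i es)) l) (ca-child i es) (cong suc (length-map _ es)) ⟩
    spectrum (edgesAbove i es + ca es) (suc n) (profile (suc m) (child i es)) l
      ↭⟨ spectrum-↭ l _ _ (profile-child es i≤2m) ⟩
    spectrum (edgesAbove i es + ca es) (suc n) (suc n ∷ edgesAbove i es ∷ profile m es) l ∎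

length-vertices : ∀ es → length (vertices es) ≡ 2 * length es
length-vertices []       = refl
length-vertices (e ∷ es) = ≡-trans (cong (λ k → 2 + k) (length-vertices es)) (sym (*-suc 2 (length es)))

length-matching : ∀ {n es} → IsMatching n es → length es ≡ n
length-matching {n} {es} match = *-cancelˡ-≡ (length es) n 2
  (≡-trans (sym (length-vertices es)) (≡-trans (↭-length match) (length-range 1 (2 * n))))

corollary4p3 : (n : ℕ) (M N : List Edge) → IsMatching n M → IsMatching n N →
    caT n M 0 ↭ caT n N 0 → caT n M 1 ↭ caT n N 1 →
    (l : ℕ) → caT n M l ↭ caT n N l
corollary4p3 n M N matchM matchN level0 level1 l = begin
  caT n M l                                     ↭⟨ caT-spectrum l n M ⟩
  spectrum (ca M) (length M) (profile n M) l    ≡⟨ cong₂ (λ a k → spectrum a k (profile n M) l) ca≡ length≡ ⟩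
  spectrum (ca N) (length N) (profile n M) l    ↭⟨ spectrum-↭ l _ _ profile↭ ⟩
  spectrum (ca N) (length N) (profile n N) l    ↭⟨ caT-spectrum l n N ⟨
  caT n N l                                     ∎
  where
  open PermutationReasoning
  ca≡ : ca M ≡ ca N
  ca≡ = ∷-injectiveˡ (↭-singleton-inv level0)
  length≡ : length M ≡ length N
  length≡ = ≡-trans (length-matching {n} {M} matchM) (sym (length-matching {n} {N} matchN))
  profile↭ : profile n M ↭ profile n N
  profile↭ = map⁺-cancel (_∸ ca N) (λ c → m+n∸n≡m c (ca N)) (begin
    map (_+ ca N) (profile n M)                 ≡⟨ cong (λ a → map (_+ a) (profile n M)) ca≡ ⟨
    map (_+ ca M) (profile n M)                 ≡⟨ spectrum-one (ca M) (length M) (profile n M) ⟨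
    spectrum (ca M) (length M) (profile n M) 1  ↭⟨ caT-spectrum 1 n M ⟨
    caT n M 1                                   ↭⟨ level1 ⟩
    caT n N 1                                   ↭⟨ caT-spectrum 1 n N ⟩
    spectrum (ca N) (length N) (profile n N) 1  ≡⟨ spectrum-one (ca N) (length N) (profile n N) ⟩
    map (_+ ca N) (profile n N)                 ∎)
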